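{- Let $G,H$ be impartial games such that $H$ is revertible to $G$. Then $o(H+X)\subseteq o(G+X)$ for every impartial game $X$.
   Context: All games are short impartial games (identified with the finite set of their options, no infinite runs); $+$ is the disjunctive sum. There are $N\ge2$ players moving cyclically; under normal play the player unable to move on their turn is the unique loser. Relative to a position the players are $\mathbf N=\mathbf O_0,\mathbf O_1,\dots,\mathbf O_{N-2},\mathbf P=\mathbf O_{N-1}$ ($\mathbf O_i$ moves $i$ turns after $\mathbf N$), and the outcome $o(G)$ is defined recursively: $\mathbf N\in o(G)$ iff some option $G'$ has $\mathbf P\in o(G')$; for $1\le i\le N-1$, $\mathbf O_i\in o(G)$ iff every option $G'$ has $\mathbf O_{i-1}\in o(G')$. Two games are equal, $G=H$, if $o(G+X)=o(H+X)$ for all impartial games $X$. $H$ is revertible to $G$ if (i) for every option $G'$ of $G$, $H$ has an option equal to $G'$, and (ii) for every option $H'$ of $H$ not equal to any option of $G$, there is a sequence $H'=K_0,K_1,\dots,K_{N-1}$ with each $K_{j+1}$ an option of $K_j$ and $K_{N-1}=G$ (i.e. an $(N-1)$st option of $H'$ equal to $G$). -}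

module Defs where

open import Data.Nat using (ℕ; zero; suc)
open import Data.Fin using (Fin; zero; suc; fromℕ; inject₁)
open import Data.Bool using (Bool; true; false; _∧_; _∨_)
open import Data.List using (List; []; _∷_; _++_)
open import Data.List.Membership.Propositional using (_∈_)
open import Data.Product using (Σ; _×_; _,_)
open import Relation.Binary.PropositionalEquality using (_≡_)
open import Relation.Nullary using (¬_)

-- Short impartial games: a game is (identified with) its finite list of options.
data Game : Set where
  mk : List Game → Game

options : Game → List Game
options (mk gs) = gs

mutual
  _+_ : Game → Game → Game
  G@(mk gs) + X@(mk xs) = mk (leftMoves gs X ++ rightMoves G xs)

  leftMoves : List Game → Game → List Game
  leftMoves [] X = []
  leftMoves (g ∷ gs) X = (g + X) ∷ leftMoves gs X

  rightMoves : Game → List Game → List Game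
  rightMoves G [] = []
  rightMoves G (x ∷ xs) = (G + x) ∷ rightMoves G xs

infixl 6 _+_

-- Outcomes for N = suc n players. Players relative to a position are
-- O_0 = N (zero), O_1, ..., O_{N-1} = P (fromℕ n).
-- out n G i ≡ true  means  O_i ∈ o(G).
mutual
  out : (n : ℕ) → Game → Fin (suc n) → Bool
  out n (mk gs) zero = someP n gs
  out n (mk gs) (suc i) = allO n (inject₁ i) gs

  someP : (n : ℕ) → List Game → Bool
  someP n [] = false
  someP n (g ∷ gs) = out n g (fromℕ n) ∨ someP n gs

  allO : (n : ℕ) → Fin (suc n) → List Game → Bool
  allO n j [] = true
  allO n j (g ∷ gs) = out n g j ∧ allO n j gs

_∈o_ : {n : ℕ} → Fin (suc n) → Game → Set
_∈o_ {n} i G = out n G i ≡ true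

_⊆o_ : {n : ℕ} → Game → Game → Set
_⊆o_ {n} G H = (i : Fin (suc n)) → _∈o_ {n} i G → _∈o_ {n} i H

_≈_ : {n : ℕ} → Game → Game → Set
_≈_ {n} G H = (X : Game) (i : Fin (suc n)) → out n (G + X) i ≡ out n (H + X) i

IterOption : ℕ → Game → Game → Set
IterOption zero K L = L ≡ K
IterOption (suc k) K L = Σ Game λ K' → K' ∈ options K × IterOption k K' L

Revertible : (n : ℕ) → Game → Game → Set
Revertible n H G =
  ((G' : Game) → G' ∈ options G →
     Σ Game λ H' → H' ∈ options H × _≈_ {n} H' G')
  ×
  ((H' : Game) → H' ∈ options H →
     ¬ (Σ Game λ G' → G' ∈ options G × _≈_ {n} H' G') →
     Σ Game λ L → IterOption n H' L × _≈_ {n} L G)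

module Submission where

-- We show o(H + X) ⊆ o(G + X) by induction on X, splitting on
-- the player O_i.
--   * i = 0 (N wins H + X): N has a move to a position with P in its outcome.
--     A move H + X' in X is answered by G + X', by induction.  A move H' + X
--     in H is answered by G' + X if H' equals an option G' of G; otherwise
--     revertibility gives an (N-1)st option L of H' equal to G, and since
--     P = O_{N-1} ∈ o(H' + X), walking the N-1 moves down to L + X shows
--     N ∈ o(L + X) = o(G + X).  As "H' equals an option of G" is not
--     decidable, we case on the boolean N ∈ o(G + X) instead.
--   * i = j+1: every option of G + X must have O_j.  Options G + X' follow by
--     induction; an option G' + X has an equal option H' of H by
--     revertibility (i), and H' + X is an option of H + X.

open import Defs
open import Data.Nat using (ℕ; _≤_; zero; suc)
open import Data.Nat.Properties using (suc-injective)
open import Data.Fin using (Fin; zero; suc; toℕ; fromℕ; inject₁)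
open import Data.Fin.Properties using (toℕ-inject₁; toℕ-fromℕ)
open import Data.Bool using (true; false)
open import Data.List using ([]; _∷_)
open import Data.List.Membership.Propositional using (_∈_)
open import Data.List.Membership.Propositional.Properties using (∈-++⁺ˡ; ∈-++⁺ʳ; ∈-++⁻)
open import Data.List.Relation.Unary.Any using (here; there)
open import Data.List.Relation.Unary.All as All using (All; []; _∷_)
open import Data.Product using (Σ; _×_; _,_; proj₁; proj₂)
open import Data.Sum using (_⊎_; inj₁; inj₂)
open import Relation.Nullary using (¬_)
open import Relation.Binary.PropositionalEquality using (_≡_; refl; sym; trans)

mutual
  gameInd : ∀ {ℓ} (P : Game → Set ℓ) → (∀ xs → All P xs → P (mk xs)) →
            ∀ X → P X
  gameInd P step (mk xs) = step xs (gameIndAll P step xs)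

  gameIndAll : ∀ {ℓ} (P : Game → Set ℓ) → (∀ xs → All P xs → P (mk xs)) →
               ∀ xs → All P xs
  gameIndAll P step [] = []
  gameIndAll P step (x ∷ xs) = gameInd P step x ∷ gameIndAll P step xs

left-option : ∀ {G'} G X → G' ∈ options G → G' + X ∈ options (G + X)
left-option {G'} (mk gs) X@(mk _) p = ∈-++⁺ˡ (leftMoves-∈ p)
  where
    leftMoves-∈ : ∀ {gs} → G' ∈ gs → G' + X ∈ leftMoves gs X
    leftMoves-∈ (here refl) = here refl
    leftMoves-∈ (there q) = there (leftMoves-∈ q)

right-option : ∀ {X'} G X → X' ∈ options X → G + X' ∈ options (G + X)
right-option {X'} (mk gs) (mk xs) p = ∈-++⁺ʳ (leftMoves gs (mk xs)) (rightMoves-∈ p)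
  where
    rightMoves-∈ : ∀ {xs} → X' ∈ xs → mk gs + X' ∈ rightMoves (mk gs) xs
    rightMoves-∈ (here refl) = here refl
    rightMoves-∈ (there q) = there (rightMoves-∈ q)

sum-option-cases : ∀ {Y} G X → Y ∈ options (G + X) →
  (Σ Game λ G' → G' ∈ options G × Y ≡ G' + X) ⊎
  (Σ Game λ X' → X' ∈ options X × Y ≡ G + X')
sum-option-cases (mk gs) (mk xs) p with ∈-++⁻ (leftMoves gs (mk xs)) p
... | inj₁ q = inj₁ (fromLeft gs q)
  where
    fromLeft : ∀ {Y} gs → Y ∈ leftMoves gs (mk xs) →
               Σ Game λ G' → G' ∈ gs × Y ≡ G' + mk xs
    fromLeft (g ∷ gs) (here refl) = g , here refl , refl
    fromLeft (g ∷ gs) (there q) with fromLeft gs q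
    ... | G' , G'∈ , eq = G' , there G'∈ , eq
... | inj₂ q = inj₂ (fromRight xs q)
  where
    fromRight : ∀ {Y} xs → Y ∈ rightMoves (mk gs) xs →
                Σ Game λ X' → X' ∈ xs × Y ≡ mk gs + X'
    fromRight (x ∷ xs) (here refl) = x , here refl , refl
    fromRight (x ∷ xs) (there q) with fromRight xs q
    ... | X' , X'∈ , eq = X' , there X'∈ , eq

module Outcomes (n : ℕ) where

  P : Fin (suc n)
  P = fromℕ n

  N-wins-elim : ∀ K → out n K zero ≡ true →
                Σ Game λ K' → K' ∈ options K × out n K' P ≡ true
  N-wins-elim (mk gs) = someP-elim gs
    where
      someP-elim : ∀ gs → someP n gs ≡ true →
                   Σ Game λ g → g ∈ gs × out n g P ≡ true
      someP-elim (g ∷ gs) e with out n g P in eq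
      ... | true = g , here refl , eq
      ... | false with someP-elim gs e
      ...   | g' , g'∈ , e' = g' , there g'∈ , e'

  N-wins-intro : ∀ {K'} K → K' ∈ options K → out n K' P ≡ true →
                 out n K zero ≡ true
  N-wins-intro (mk gs) = someP-intro gs
    where
      someP-intro : ∀ {g} gs → g ∈ gs → out n g P ≡ true → someP n gs ≡ true
      someP-intro (g ∷ gs) (here refl) e rewrite e = refl
      someP-intro (g ∷ gs) (there p) e with out n g P
      ... | true = refl
      ... | false = someP-intro gs p e

  O-suc-elim : ∀ {K'} K j → out n K (suc j) ≡ true → K' ∈ options K →
               out n K' (inject₁ j) ≡ true
  O-suc-elim (mk gs) j = allO-elim gs
    where
      allO-elim : ∀ {g} gs → allO n (inject₁ j) gs ≡ true → g ∈ gs →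
                  out n g (inject₁ j) ≡ true
      allO-elim (g ∷ gs) e p with out n g (inject₁ j) in eq
      allO-elim (g ∷ gs) e (here refl) | true = eq
      allO-elim (g ∷ gs) e (there p)   | true = allO-elim gs e p

  O-suc-intro : ∀ K j → (∀ {K'} → K' ∈ options K → out n K' (inject₁ j) ≡ true) →
                out n K (suc j) ≡ true
  O-suc-intro (mk gs) j = allO-intro gs
    where
      allO-intro : ∀ gs → (∀ {g} → g ∈ gs → out n g (inject₁ j) ≡ true) →
                   allO n (inject₁ j) gs ≡ true
      allO-intro [] f = refl
      allO-intro (g ∷ gs) f rewrite f (here refl) = allO-intro gs (λ p → f (there p))

  -- Descent: if O_k ∈ o(K + X) and L is a k-th option of K, then
  -- N ∈ o(L + X); each move in the K component lowers the index by one.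
  descent : ∀ k {K L X} (i : Fin (suc n)) → toℕ i ≡ k → IterOption k K L →
            out n (K + X) i ≡ true → out n (L + X) zero ≡ true
  descent zero    zero    _  refl e = e
  descent (suc k) {K} {X = X} (suc j) ij (K' , K'∈ , it) e =
    descent k (inject₁ j) (trans (toℕ-inject₁ j) (suc-injective ij)) it
      (O-suc-elim (K + X) j e (left-option K X K'∈))

  transport : ∀ K L → _≈_ {n} K L → ∀ X i →
              out n (K + X) i ≡ true → out n (L + X) i ≡ true
  transport _ _ K≈L X i e = trans (sym (K≈L X i)) e

  module Revert (G H : Game) (rev : Revertible n H G) where

    Dominated : Game → Set
    Dominated X = ∀ i → out n (H + X) i ≡ true → out n (G + X) i ≡ true

    N-case : ∀ xs → All Dominated xs →
             out n (H + mk xs) zero ≡ true → out n (G + mk xs) zero ≡ true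
    N-case xs ih e with N-wins-elim (H + mk xs) e
    ... | Y , Y∈ , eY with sum-option-cases H (mk xs) Y∈
    ...   | inj₂ (X' , X'∈ , refl) =
      N-wins-intro (G + mk xs) (right-option G (mk xs) X'∈) (All.lookup ih X'∈ P eY)
    ...   | inj₁ (H' , H'∈ , refl) with out n (G + mk xs) zero in eG
    ...     | true = refl
    ...     | false = trans (sym eG)
                        (transport L G L≈G X zero (descent n P (toℕ-fromℕ n) H'↠L eY))
      where
        X : Game
        X = mk xs
        -- H' equal to an option G' would make G' + X a winning move for N.
        H'-unmatched : ¬ (Σ Game λ G' → G' ∈ options G × _≈_ {n} H' G')
        H'-unmatched (G' , G'∈ , H'≈G')
          with trans (sym eG)
                 (N-wins-intro (G + X) (left-option G X G'∈) (transport H' G' H'≈G' X P eY))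
        ... | ()
        reversal : Σ Game λ L → IterOption n H' L × _≈_ {n} L G
        reversal = proj₂ rev H' H'∈ H'-unmatched
        L : Game
        L = proj₁ reversal
        H'↠L : IterOption n H' L
        H'↠L = proj₁ (proj₂ reversal)
        L≈G : _≈_ {n} L G
        L≈G = proj₂ (proj₂ reversal)

    O-suc-case : ∀ xs j → All Dominated xs →
                 out n (H + mk xs) (suc j) ≡ true → out n (G + mk xs) (suc j) ≡ true
    O-suc-case xs j ih e = O-suc-intro (G + X) j options-have-Oj
      where
        X : Game
        X = mk xs
        options-have-Oj : ∀ {Y} → Y ∈ options (G + X) → out n Y (inject₁ j) ≡ true
        options-have-Oj Y∈ with sum-option-cases G X Y∈
        ... | inj₂ (X' , X'∈ , refl) =
          All.lookup ih X'∈ (inject₁ j) (O-suc-elim (H + X) j e (right-option H X X'∈))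
        ... | inj₁ (G' , G'∈ , refl) with proj₁ rev G' G'∈
        ...   | H' , H'∈ , H'≈G' =
          transport H' G' H'≈G' X (inject₁ j) (O-suc-elim (H + X) j e (left-option H X H'∈))

    dominated : ∀ X → Dominated X
    dominated = gameInd Dominated step
      where
        step : ∀ xs → All Dominated xs → Dominated (mk xs)
        step xs ih zero    = N-case xs ih
        step xs ih (suc j) = O-suc-case xs j ih

-- Theorem 8: if H is revertible to G then o(H + X) ⊆ o(G + X) for all X.
mainTheorem8 : (n : ℕ) → 1 ≤ n → (G H : Game) → Revertible n H G →
    (X : Game) → _⊆o_ {n} (H + X) (G + X)
mainTheorem8 n _ G H rev = Outcomes.Revert.dominated n G H rev
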